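{- Let $T$ be a rooted tree with root $v$ and let $T'$ be a proper subtree of $T$ that contains $v$, rooted at $v$. Then for every $x>0$, $\tau(S(T'),x)>\tau(S(T),x)$.
   Context: The subdivision tree $S(T)$ of a tree $T$ is obtained by inserting a new vertex into every edge of $T$; when $T$ is rooted, $S(T)$ is rooted at the same vertex. For a tree $T$, $m(T,k)$ is the number of matchings with exactly $k$ edges ($m(T,0)=1$) and $M(T,x)=\sum_{k\ge0}m(T,k)x^k$. For a rooted tree, $m_0(T,k)$ counts $k$-matchings not saturating the root, $M_0(T,x)=\sum_k m_0(T,k)x^k$, and $\tau(T,x)=M_0(T,x)/M(T,x)$. -}

module Defs where

open import Level using (0ℓ)
open import Data.Nat as ℕ using (ℕ; zero; suc)
open import Data.Bool using (Bool; true; false; _∧_; not; if_then_else_)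
open import Data.List using (List; []; _∷_; map; concatMap; length; filter; _++_; zip)
open import Data.List.Properties using (≡-dec)
open import Data.List.Relation.Binary.Sublist.Heterogeneous using (Sublist)
open import Data.Product using (_×_; _,_; proj₁; proj₂)
open import Relation.Nullary using (¬_; does)
open import Relation.Binary.PropositionalEquality using (_≡_; _≢_)
open import Algebra.Structures using (IsCommutativeRing)
open import Relation.Binary.Structures using (IsStrictTotalOrder)

data Tree : Set where
  node : List Tree → Tree

-- Rooted subtrees: T' ⊑ T means T' is a subtree of T containing the root,
-- i.e. obtained by deleting some children (order-preserving sublist) and
-- recursively passing to rooted subtrees of the kept children.
data _⊑_ : Tree → Tree → Set where
  node⊑ : ∀ {ts' ts} → Sublist _⊑_ ts' ts → node ts' ⊑ node ts

-- Subdivision tree: insert a new vertex into every edge, same root.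
S : Tree → Tree
Ss : List Tree → List Tree
S (node ts) = node (Ss ts)
Ss [] = []
Ss (t ∷ ts) = node (S t ∷ []) ∷ Ss ts

-- Vertices are named by addresses (paths of child indices from the root).

Addr : Set
Addr = List ℕ

Edge : Set
Edge = Addr × Addr

-- edges of the tree rooted at address a (addresses are stored reversed)
edgesAt : Addr → Tree → List Edge
edgesFrom : Addr → ℕ → List Tree → List Edge
edgesAt a (node ts) = edgesFrom a 0 ts
edgesFrom a i [] = []
edgesFrom a i (t ∷ ts) = (a , (i ∷ a)) ∷ (edgesAt (i ∷ a) t ++ edgesFrom a (suc i) ts)

edges : Tree → List Edge
edges = edgesAt []

root : Addr
root = []

_==ᵃ_ : Addr → Addr → Bool
a ==ᵃ b = does (≡-dec ℕ._≟_ a b)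

incident : Addr → Edge → Bool
incident v (a , b) = (a ==ᵃ v) Data.Bool.∨ (b ==ᵃ v)

disjointE : Edge → Edge → Bool
disjointE e (a , b) = not (incident a e) ∧ not (incident b e)

allᵇ : {A : Set} → (A → Bool) → List A → Bool
allᵇ p [] = true
allᵇ p (x ∷ xs) = p x ∧ allᵇ p xs

pairwiseDisjoint : List Edge → Bool
pairwiseDisjoint [] = true
pairwiseDisjoint (e ∷ es) = allᵇ (disjointE e) es ∧ pairwiseDisjoint es

subsets : {A : Set} → List A → List (List A)
subsets [] = [] ∷ []
subsets (x ∷ xs) = let r = subsets xs in r ++ map (x ∷_) r

isMatching : List Edge → Bool
isMatching = pairwiseDisjoint

filterᵇ : {A : Set} → (A → Bool) → List A → List A
filterᵇ p [] = []
filterᵇ p (x ∷ xs) = if p x then x ∷ filterᵇ p xs else filterᵇ p xs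

matchings : Tree → List (List Edge)
matchings T = filterᵇ isMatching (subsets (edges T))

matchings₀ : Tree → List (List Edge)
matchings₀ T = filterᵇ (allᵇ (λ e → not (incident root e))) (matchings T)

m : Tree → ℕ → ℕ
m T k = length (filterᵇ (λ M → length M ℕ.≡ᵇ k) (matchings T))

m₀ : Tree → ℕ → ℕ
m₀ T k = length (filterᵇ (λ M → length M ℕ.≡ᵇ k) (matchings₀ T))

-- Ordered fields (standard axioms), with a total inverse (0⁻¹ arbitrary).

record OrderedField : Set₁ where
  infixl 6 _+_
  infixl 7 _*_
  infix 4 _<_
  field
    Carrier : Set
    _+_ _*_ : Carrier → Carrier → Carrier
    -_ : Carrier → Carrier
    0# 1# : Carrier
    _⁻¹ : Carrier → Carrier
    _<_ : Carrier → Carrier → Set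
    isCommutativeRing : IsCommutativeRing _≡_ _+_ _*_ -_ 0# 1#
    isStrictTotalOrder : IsStrictTotalOrder _≡_ _<_
    0≢1 : 0# ≢ 1#
    ⁻¹-inverse : ∀ x → x ≢ 0# → x * (x ⁻¹) ≡ 1#
    +-mono-< : ∀ {a b} c → a < b → a + c < b + c
    *-pos : ∀ {a b} → 0# < a → 0# < b → 0# < a * b

module Poly (F : OrderedField) where
  open OrderedField F

  fromℕ : ℕ → Carrier
  fromℕ zero = 0#
  fromℕ (suc n) = 1# + fromℕ n

  _^_ : Carrier → ℕ → Carrier
  x ^ zero = 1#
  x ^ suc n = x * (x ^ n)

  sumTo : ℕ → (ℕ → Carrier) → Carrier
  sumTo zero f = f zero
  sumTo (suc n) f = sumTo n f + f (suc n)

  -- M(T,x) = Σ_k m(T,k) x^k ; a matching has at most |E(T)| edges.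
  M : Tree → Carrier → Carrier
  M T x = sumTo (length (edges T)) (λ k → fromℕ (m T k) * (x ^ k))

  M₀ : Tree → Carrier → Carrier
  M₀ T x = sumTo (length (edges T)) (λ k → fromℕ (m₀ T k) * (x ^ k))

  τ : Tree → Carrier → Carrier
  τ T x = M₀ T x * (M T x ⁻¹)

module Submission where

-- For every rooted tree u = node (u₁ ∷ us), splitting
-- on the edge from the root to its first child u₁ gives the matching recurrence
--     M(u)  = M(u₁) · M(node us) + x · M₀(u₁) · M₀(node us) ,
--     M₀(u) = M(u₁) · M₀(node us) ,
-- evaluated at x; matchPoly / forestPoly compute M and M₀ this way.  All values
-- are positive, and induction along ⊑ shows that deleting vertices strictly
-- increases the cross ratio (cross-<):  M₀(S T) · M(S T') < M₀(S T') · M(S T).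
-- Dividing by M(S T), M(S T') > 0 gives τ(S T, x) < τ(S T', x), which is lemma2p4.

open import Defs
open import Level using (0ℓ)
open import Algebra.Bundles using (CommutativeRing)
open import Algebra.Structures using (IsCommutativeRing)
open import Relation.Binary.Structures using (IsStrictTotalOrder)
open import Relation.Binary.Definitions using (tri<; tri≈; tri>)
open import Relation.Binary.PropositionalEquality hiding ([_])
open import Relation.Nullary using (yes; no)
open import Relation.Nullary.Decidable using (dec-true; dec-false)
open import Data.Empty using (⊥-elim)
open import Data.Sum using (_⊎_; inj₁; inj₂; [_,_])
import Data.Sum as Sum
open import Data.Product using (_×_; _,_; proj₁; proj₂; Σ)
open import Data.Bool using (Bool; true; false; _∧_; _∨_; not; if_then_else_)
open import Data.Bool.Properties using (∨-identityʳ; ∧-identityʳ; ∧-zeroʳ)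
open import Data.Nat as ℕ using (ℕ; zero; suc; z≤n; s≤s)
open import Data.Nat.Properties as ℕP using (≤-refl; n≤1+n; ≤-trans)
open import Data.List using (List; []; _∷_; _++_; length; map)
open import Data.List.Properties using (≡-dec)
open import Data.List.Relation.Unary.All as All using (All; []; _∷_)
open import Data.List.Relation.Unary.All.Properties using (++⁺; map⁺)
open import Data.List.Relation.Binary.Sublist.Heterogeneous using (Sublist; []; _∷ʳ_; _∷_)

commutativeRing : OrderedField → CommutativeRing 0ℓ 0ℓ
commutativeRing F = record { isCommutativeRing = OrderedField.isCommutativeRing F }

module OrderedFieldFacts (F : OrderedField) where
  open OrderedField F
  open IsCommutativeRing isCommutativeRing
    using (+-comm; *-comm; +-assoc; +-identityˡ; +-identityʳ; -‿inverseˡ; -‿inverseʳ;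
           zeroʳ; *-identityʳ; distribʳ)
  open IsStrictTotalOrder isStrictTotalOrder using (compare; irrefl; asym) renaming (trans to <-trans)
  open import Algebra.Properties.Ring (CommutativeRing.ring (commutativeRing F))
    using (-1*x≈-x; -‿involutive; -‿distribʳ-*)
  open import Algebra.Solver.Ring.NaturalCoefficients.Default
    (CommutativeRing.commutativeSemiring (commutativeRing F))
  open ≡-Reasoning

  +-monoˡ-< : ∀ c {a b} → a < b → c + a < c + b
  +-monoˡ-< c {a} {b} a<b = subst₂ _<_ (+-comm a c) (+-comm b c) (+-mono-< c a<b)

  <-+-pos : ∀ {a} b → 0# < a → b < a + b
  <-+-pos {a} b a>0 = subst (_< a + b) (+-identityˡ b) (+-mono-< b a>0)

  pos-+ : ∀ {a b} → 0# < a → 0# < b → 0# < a + b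
  pos-+ a>0 b>0 = <-trans b>0 (<-+-pos _ a>0)

  neg⇒-pos : ∀ {a} → a < 0# → 0# < - a
  neg⇒-pos {a} a<0 = subst₂ _<_ (-‿inverseʳ a) (+-identityˡ (- a)) (+-mono-< (- a) a<0)

  *-monoʳ-< : ∀ {a b c} → 0# < c → a < b → a * c < b * c
  *-monoʳ-< {a} {b} {c} c>0 a<b =
    subst₂ _<_ (+-identityˡ (a * c)) split (+-mono-< (a * c) (*-pos b-a>0 c>0))
    where
      b-a>0 : 0# < b + - a
      b-a>0 = subst (_< _) (-‿inverseʳ a) (+-mono-< (- a) a<b)
      split : (b + - a) * c + a * c ≡ b * c
      split = begin
        (b + - a) * c + a * c  ≡⟨ distribʳ c (b + - a) a ⟨
        (b + - a + a) * c      ≡⟨ cong (_* c) (+-assoc b (- a) a) ⟩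
        (b + (- a + a)) * c    ≡⟨ cong (λ z → (b + z) * c) (-‿inverseˡ a) ⟩
        (b + 0#) * c           ≡⟨ cong (_* c) (+-identityʳ b) ⟩
        b * c                  ∎

  *-monoˡ-< : ∀ {a b c} → 0# < c → a < b → c * a < c * b
  *-monoˡ-< {a} {b} {c} c>0 a<b = subst₂ _<_ (*-comm a c) (*-comm b c) (*-monoʳ-< c>0 a<b)

  -- if 1 < 0 then -1 > 0, so 1 = (-1)·(-1) > 0
  0<1 : 0# < 1#
  0<1 with compare 0# 1#
  ... | tri< 0<1 _ _ = 0<1
  ... | tri≈ _ 0≡1 _ = ⊥-elim (0≢1 0≡1)
  ... | tri> _ _ 1<0 = ⊥-elim (asym 1<0 (subst (0# <_) square (*-pos -1>0 -1>0)))
    where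
      -1>0 : 0# < - 1#
      -1>0 = neg⇒-pos 1<0
      square : - 1# * - 1# ≡ 1#
      square = trans (-1*x≈-x (- 1#)) (-‿involutive 1#)

  pos⇒≢0 : ∀ {a} → 0# < a → a ≢ 0#
  pos⇒≢0 a>0 a≡0 = irrefl (sym a≡0) a>0

  -- a⁻¹ = 0 would give 1 = a a⁻¹ = 0, and a⁻¹ < 0 would give -1 = a·(-a⁻¹) > 0
  ⁻¹-pos : ∀ {a} → 0# < a → 0# < a ⁻¹
  ⁻¹-pos {a} a>0 with compare 0# (a ⁻¹)
  ... | tri< a⁻¹>0 _ _ = a⁻¹>0
  ... | tri≈ _ 0≡a⁻¹ _ =
    ⊥-elim (0≢1 (trans (sym (zeroʳ a)) (trans (cong (a *_) 0≡a⁻¹) (⁻¹-inverse a (pos⇒≢0 a>0)))))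
  ... | tri> _ _ a⁻¹<0 = ⊥-elim (irrefl (sym (-‿inverseˡ 1#)) (pos-+ -1>0 0<1))
    where
      -1>0 : 0# < - 1#
      -1>0 = subst (0# <_) (trans (sym (-‿distribʳ-* a (a ⁻¹))) (cong -_ (⁻¹-inverse a (pos⇒≢0 a>0))))
                   (*-pos a>0 (neg⇒-pos a⁻¹<0))

  quotient-< : ∀ {p a p' a'} → 0# < a → 0# < a' → p * a' < p' * a → p * a ⁻¹ < p' * a' ⁻¹
  quotient-< {p} {a} {p'} {a'} a>0 a'>0 cross =
    subst₂ _<_ (cancel p a'>0) (trans (cong ((p' * a) *_) (*-comm (a ⁻¹) (a' ⁻¹))) (cancel p' a>0))
          (*-monoʳ-< (*-pos (⁻¹-pos a>0) (⁻¹-pos a'>0)) cross)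
    where
      cancel : ∀ u {v w} → 0# < v → (u * v) * (w * v ⁻¹) ≡ u * w
      cancel u {v} {w} v>0 = begin
        (u * v) * (w * v ⁻¹)
          ≡⟨ solve 4 (λ u v w z → (u :* v) :* (w :* z) := (u :* w) :* (v :* z)) refl u v w (v ⁻¹) ⟩
        (u * w) * (v * v ⁻¹)  ≡⟨ cong ((u * w) *_) (⁻¹-inverse v (pos⇒≢0 v>0)) ⟩
        (u * w) * 1#          ≡⟨ *-identityʳ (u * w) ⟩
        u * w                 ∎

  infix 4 _≤_
  _≤_ : Carrier → Carrier → Set
  a ≤ b = a ≡ b ⊎ a < b

  ≤-<-trans : ∀ {a b c} → a ≤ b → b < c → a < c
  ≤-<-trans (inj₁ refl) b<c = b<c
  ≤-<-trans (inj₂ a<b)  b<c = <-trans a<b b<c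

  *-monoˡ-≤ : ∀ {a b c} → 0# < c → a ≤ b → c * a ≤ c * b
  *-monoˡ-≤ c>0 (inj₁ refl) = inj₁ refl
  *-monoˡ-≤ c>0 (inj₂ a<b)  = inj₂ (*-monoˡ-< c>0 a<b)

  weighted-< : ∀ {k l u u' v v'} → 0# < k → 0# < l →
    (u < u' × v ≤ v') ⊎ (u ≤ u' × v < v') → k * u + l * v < k * u' + l * v'
  weighted-< {k} {l} {u} {u'} {v} {v'} k>0 l>0 (inj₁ (u<u' , v≤v')) with *-monoˡ-≤ l>0 v≤v'
  ... | inj₁ lv≡lv' = subst (λ z → k * u + l * v < k * u' + z) lv≡lv' (+-mono-< (l * v) (*-monoˡ-< k>0 u<u'))
  ... | inj₂ lv<lv' = <-trans (+-mono-< (l * v) (*-monoˡ-< k>0 u<u')) (+-monoˡ-< (k * u') lv<lv')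
  weighted-< {k} {l} {u} {u'} {v} {v'} k>0 l>0 (inj₂ (u≤u' , v<v')) with *-monoˡ-≤ k>0 u≤u'
  ... | inj₁ ku≡ku' = subst (λ z → k * u + l * v < z + l * v') ku≡ku' (+-monoˡ-< (k * u) (*-monoˡ-< l>0 v<v'))
  ... | inj₂ ku<ku' = <-trans (+-mono-< (l * v) ku<ku') (+-monoˡ-< (k * u') (*-monoˡ-< l>0 v<v'))

-- Addresses.  The child number k of the vertex with address a has address
-- k ∷ a, so the vertices of the subtree rooted at b are the extensions of b.

data Below (b : Addr) : Addr → Set where
  here  : Below b b
  there : ∀ {u} k → Below b u → Below b (k ∷ u)

Below-length : ∀ {b u} → Below b u → length b ℕ.≤ length u
Below-length here        = ≤-refl
Below-length (there k p) = ≤-trans (Below-length p) (n≤1+n _)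

Below-parent : ∀ {i b u} → Below (i ∷ b) u → Below b u
Below-parent here        = there _ here
Below-parent (there k p) = there k (Below-parent p)

Below-child-≢ : ∀ {i b u} → Below (i ∷ b) u → u ≢ b
Below-child-≢ p refl = ℕP.<-irrefl refl (Below-length p)

Below-child-unique : ∀ {i j a u} → Below (i ∷ a) u → Below (j ∷ a) u → i ≡ j
Below-child-unique here        here         = refl
Below-child-unique here        (there k q)  = ⊥-elim (Below-child-≢ q refl)
Below-child-unique (there k p) here         = ⊥-elim (Below-child-≢ p refl)
Below-child-unique (there k p) (there .k q) = Below-child-unique p q

UnderFrom : Addr → ℕ → Addr → Set
UnderFrom a i u = u ≡ a ⊎ Σ ℕ (λ j → i ℕ.≤ j × Below (j ∷ a) u)

Both : (Addr → Set) → Edge → Set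
Both P (u , v) = P u × P v

mutual
  edgesAt-endpoints : ∀ b t → All (Both (Below b)) (edgesAt b t)
  edgesAt-endpoints b (node ts) = All.map (λ { (p , q) → below p , below q }) (edgesFrom-endpoints b 0 ts)
    where
      below : ∀ {u} → UnderFrom b 0 u → Below b u
      below (inj₁ refl)        = here
      below (inj₂ (_ , _ , p)) = Below-parent p

  edgesFrom-endpoints : ∀ a i ts → All (Both (UnderFrom a i)) (edgesFrom a i ts)
  edgesFrom-endpoints a i []       = []
  edgesFrom-endpoints a i (t ∷ ts) =
    (inj₁ refl , inj₂ (i , ≤-refl , here)) ∷
    ++⁺ (All.map (λ { (p , q) → inj₂ (i , ≤-refl , p) , inj₂ (i , ≤-refl , q) }) (edgesAt-endpoints (i ∷ a) t))
        (All.map (λ { (p , q) → widen p , widen q }) (edgesFrom-endpoints a (suc i) ts))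
    where
      widen : ∀ {u} → UnderFrom a (suc i) u → UnderFrom a i u
      widen (inj₁ u≡a)            = inj₁ u≡a
      widen (inj₂ (j , i<j , p)) = inj₂ (j , ≤-trans (n≤1+n i) i<j , p)

separated : ∀ {i a u v} → Below (i ∷ a) u → UnderFrom a (suc i) v → u ≢ v
separated p (inj₁ refl)            refl = Below-child-≢ p refl
separated p (inj₂ (j , i<j , q)) refl with Below-child-unique p q
... | refl = ℕP.<-irrefl refl i<j

==ᵃ-refl : ∀ a → (a ==ᵃ a) ≡ true
==ᵃ-refl a = dec-true (≡-dec ℕ._≟_ a a) refl

==ᵃ-false : ∀ {a b} → a ≢ b → (a ==ᵃ b) ≡ false
==ᵃ-false {a} {b} a≢b = dec-false (≡-dec ℕ._≟_ a b) a≢b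

==ᵃ-sym : ∀ a b → (a ==ᵃ b) ≡ (b ==ᵃ a)
==ᵃ-sym a b with ≡-dec ℕ._≟_ a b
... | yes refl = sym (==ᵃ-refl a)
... | no a≢b = sym (==ᵃ-false (λ b≡a → a≢b (sym b≡a)))

avoids : Addr → Edge → Bool
avoids v e = not (incident v e)

avoids-own : ∀ p q → avoids p (p , q) ≡ false
avoids-own p q rewrite ==ᵃ-refl p = refl

avoids-true : ∀ {a u v} → u ≢ a → v ≢ a → avoids a (u , v) ≡ true
avoids-true u≢a v≢a rewrite ==ᵃ-false u≢a | ==ᵃ-false v≢a = refl

disjoint-true : ∀ {p q u v} → p ≢ u → q ≢ u → p ≢ v → q ≢ v → disjointE (p , q) (u , v) ≡ true
disjoint-true p≢u q≢u p≢v q≢v = cong₂ _∧_ (avoids-true p≢u q≢u) (avoids-true p≢v q≢v)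

not-∨ : ∀ b c → not b ∧ not c ≡ not (b ∨ c)
not-∨ true  c = refl
not-∨ false c = refl

disjoint-via-second : ∀ {w} z u v → w ≢ u → w ≢ v → disjointE (w , z) (u , v) ≡ avoids z (u , v)
disjoint-via-second z u v w≢u w≢v
  rewrite ==ᵃ-false w≢u | ==ᵃ-false w≢v | ==ᵃ-sym u z | ==ᵃ-sym v z = not-∨ (z ==ᵃ u) (z ==ᵃ v)

disjoint-via-first : ∀ w {z} u v → z ≢ u → z ≢ v → disjointE (w , z) (u , v) ≡ avoids w (u , v)
disjoint-via-first w u v z≢u z≢v
  rewrite ==ᵃ-false z≢u | ==ᵃ-false z≢v | ∨-identityʳ (w ==ᵃ u) | ∨-identityʳ (w ==ᵃ v)
        | ==ᵃ-sym u w | ==ᵃ-sym v w = not-∨ (w ==ᵃ u) (w ==ᵃ v)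

-- Part 1: the matching recurrence for arbitrary rooted trees.

module MatchingRecurrence (F : OrderedField) (x : OrderedField.Carrier F) where
  open OrderedField F using (Carrier; _+_; _*_; 0#; 1#; _⁻¹)
  open IsCommutativeRing (OrderedField.isCommutativeRing F)
    using (+-assoc; +-identityˡ; +-identityʳ; *-identityˡ; zeroˡ; zeroʳ; distribˡ; distribʳ)
  open import Algebra.Solver.Ring.NaturalCoefficients.Default
    (CommutativeRing.commutativeSemiring (commutativeRing F))
  open Poly F using (M; M₀; τ; fromℕ; sumTo; _^_)
  open ≡-Reasoning

  -- M(u,x) and M₀(u,x) by recursion on the forest of children: the root either
  -- leaves its first child u unmatched, or is matched to it
  mutual
    matchPoly : Tree → Carrier
    matchPoly (node us) = forestPoly us

    matchPoly₀ : Tree → Carrier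
    matchPoly₀ (node us) = forestPoly₀ us

    forestPoly : List Tree → Carrier
    forestPoly []       = 1#
    forestPoly (u ∷ us) = matchPoly u * forestPoly us + x * (matchPoly₀ u * forestPoly₀ us)

    forestPoly₀ : List Tree → Carrier
    forestPoly₀ []       = 1#
    forestPoly₀ (u ∷ us) = matchPoly u * forestPoly₀ us

  -- the sum of x^|S| over the matchings S ⊆ L whose edges all satisfy P: the
  -- first edge e is either unused, or used and then every other edge avoids it
  G : (Edge → Bool) → List Edge → Carrier
  G P []      = 1#
  G P (e ∷ L) = G P L + (if P e then x * G (λ f → P f ∧ disjointE e f) L else 0#)

  keepAll : Edge → Bool
  keepAll _ = true

  G-cong : ∀ {P Q} L → All (λ f → P f ≡ Q f) L → G P L ≡ G Q L
  G-cong []      _                  = refl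
  G-cong {P} {Q} (e ∷ L) (Pe≡Qe ∷ P≡Q) rewrite Pe≡Qe =
    cong₂ _+_ (G-cong L P≡Q)
              (cong (λ g → if Q e then x * g else 0#)
                    (G-cong L (All.map (λ {f} Pf≡Qf → cong (_∧ disjointE e f) Pf≡Qf) P≡Q)))

  G-skip : ∀ {P e} L → P e ≡ false → G P (e ∷ L) ≡ G P L
  G-skip L Pe≡false rewrite Pe≡false = +-identityʳ _

  G-++ : ∀ {P} L₁ L₂ → All (λ e → All (λ f → disjointE e f ≡ true) L₂) L₁ →
         G P (L₁ ++ L₂) ≡ G P L₁ * G P L₂
  G-++ []       L₂ _                = sym (*-identityˡ _)
  G-++ {P} (e ∷ L₁) L₂ (e#L₂ ∷ L₁#L₂) = begin
    G P (L₁ ++ L₂) + (if P e then x * G Pe (L₁ ++ L₂) else 0#)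
      ≡⟨ cong₂ (λ g h → g + (if P e then x * h else 0#)) (G-++ L₁ L₂ L₁#L₂) (G-++ L₁ L₂ L₁#L₂) ⟩
    G P L₁ * G P L₂ + (if P e then x * (G Pe L₁ * G Pe L₂) else 0#)
      ≡⟨ cong (λ h → G P L₁ * G P L₂ + (if P e then x * (G Pe L₁ * h) else 0#)) (G-cong L₂ Pe≡P) ⟩
    G P L₁ * G P L₂ + (if P e then x * (G Pe L₁ * G P L₂) else 0#)
      ≡⟨ factor (P e) ⟩
    (G P L₁ + (if P e then x * G Pe L₁ else 0#)) * G P L₂
      ∎
    where
      Pe : Edge → Bool
      Pe f = P f ∧ disjointE e f
      Pe≡P : All (λ f → Pe f ≡ P f) L₂
      Pe≡P = All.map (λ {f} e#f → trans (cong (P f ∧_) e#f) (∧-identityʳ (P f))) e#L₂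
      factor : ∀ b → G P L₁ * G P L₂ + (if b then x * (G Pe L₁ * G P L₂) else 0#)
                   ≡ (G P L₁ + (if b then x * G Pe L₁ else 0#)) * G P L₂
      factor true  = solve 4 (λ x g h k → g :* k :+ x :* (h :* k) := (g :+ x :* h) :* k) refl
                             x (G P L₁) (G Pe L₁) (G P L₂)
      factor false = trans (+-identityʳ _) (cong (_* G P L₂) (sym (+-identityʳ _)))

  block-G : ∀ {a i} E rest → All (Both (Below (i ∷ a))) E → All (Both (UnderFrom a (suc i))) rest →
      G keepAll ((a , i ∷ a) ∷ E ++ rest)
        ≡ G keepAll E * G keepAll rest + x * (G (avoids (i ∷ a)) E * G (avoids a) rest)
    × G (avoids a) ((a , i ∷ a) ∷ E ++ rest) ≡ G keepAll E * G (avoids a) rest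
  block-G {a} {i} E rest E-below rest-later = all-matchings , root-free
    where
      b : Addr
      b = i ∷ a
      E#rest : All (λ e → All (λ f → disjointE e f ≡ true) rest) E
      E#rest = All.map (λ { {p , q} (p↓ , q↓) → All.map (λ { {u , v} (u↓ , v↓) →
                 disjoint-true (separated p↓ u↓) (separated q↓ u↓) (separated p↓ v↓) (separated q↓ v↓) })
               rest-later }) E-below
      meets-E : All (λ f → disjointE (a , b) f ≡ avoids b f) E
      meets-E = All.map (λ { {u , v} (u↓ , v↓) →
                  disjoint-via-second b u v (≢-sym (Below-child-≢ u↓)) (≢-sym (Below-child-≢ v↓)) }) E-below
      meets-rest : All (λ f → disjointE (a , b) f ≡ avoids a f) rest
      meets-rest = All.map (λ { {u , v} (u↓ , v↓) →
                     disjoint-via-first a u v (separated here u↓) (separated here v↓) }) rest-later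
      all-matchings : G keepAll ((a , b) ∷ E ++ rest)
                        ≡ G keepAll E * G keepAll rest + x * (G (avoids b) E * G (avoids a) rest)
      all-matchings = begin
        G keepAll (E ++ rest) + x * G (disjointE (a , b)) (E ++ rest)
          ≡⟨ cong₂ (λ g h → g + x * h) (G-++ E rest E#rest) (G-++ E rest E#rest) ⟩
        G keepAll E * G keepAll rest + x * (G (disjointE (a , b)) E * G (disjointE (a , b)) rest)
          ≡⟨ cong₂ (λ g h → G keepAll E * G keepAll rest + x * (g * h))
                   (G-cong E meets-E) (G-cong rest meets-rest) ⟩
        G keepAll E * G keepAll rest + x * (G (avoids b) E * G (avoids a) rest)
          ∎
      root-free : G (avoids a) ((a , b) ∷ E ++ rest) ≡ G keepAll E * G (avoids a) rest
      root-free = begin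
        G (avoids a) ((a , b) ∷ E ++ rest)  ≡⟨ G-skip {avoids a} {a , b} (E ++ rest) (avoids-own a b) ⟩
        G (avoids a) (E ++ rest)            ≡⟨ G-++ E rest E#rest ⟩
        G (avoids a) E * G (avoids a) rest  ≡⟨ cong (_* G (avoids a) rest) (G-cong E E-avoids-a) ⟩
        G keepAll E * G (avoids a) rest     ∎
        where
          E-avoids-a : All (λ f → avoids a f ≡ true) E
          E-avoids-a = All.map (λ { {u , v} (u↓ , v↓) →
                         avoids-true (Below-child-≢ u↓) (Below-child-≢ v↓) }) E-below

  mutual
    edgesAt-G : ∀ a u → G keepAll (edgesAt a u) ≡ matchPoly u × G (avoids a) (edgesAt a u) ≡ matchPoly₀ u
    edgesAt-G a (node us) = edgesFrom-G a 0 us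

    edgesFrom-G : ∀ a i us →
      G keepAll (edgesFrom a i us) ≡ forestPoly us × G (avoids a) (edgesFrom a i us) ≡ forestPoly₀ us
    edgesFrom-G a i []       = refl , refl
    edgesFrom-G a i (u ∷ us) =
        trans (proj₁ block) (cong₂ (λ g h → g + x * h) (cong₂ _*_ Pu Pus) (cong₂ _*_ P₀u P₀us))
      , trans (proj₂ block) (cong₂ _*_ Pu P₀us)
      where
        E rest : List Edge
        E    = edgesAt (i ∷ a) u
        rest = edgesFrom a (suc i) us
        block : G keepAll (edgesFrom a i (u ∷ us))
                  ≡ G keepAll E * G keepAll rest + x * (G (avoids (i ∷ a)) E * G (avoids a) rest)
              × G (avoids a) (edgesFrom a i (u ∷ us)) ≡ G keepAll E * G (avoids a) rest
        block = block-G E rest (edgesAt-endpoints (i ∷ a) u) (edgesFrom-endpoints a (suc i) us)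
        Pu : G keepAll E ≡ matchPoly u
        Pu = proj₁ (edgesAt-G (i ∷ a) u)
        P₀u : G (avoids (i ∷ a)) E ≡ matchPoly₀ u
        P₀u = proj₂ (edgesAt-G (i ∷ a) u)
        Pus : G keepAll rest ≡ forestPoly us
        Pus = proj₁ (edgesFrom-G a (suc i) us)
        P₀us : G (avoids a) rest ≡ forestPoly₀ us
        P₀us = proj₂ (edgesFrom-G a (suc i) us)

  weight : (List Edge → Bool) → List (List Edge) → Carrier
  weight p []          = 0#
  weight p (es ∷ ess) = (if p es then x ^ length es else 0#) + weight p ess

  weight-++ : ∀ p ess₁ ess₂ → weight p (ess₁ ++ ess₂) ≡ weight p ess₁ + weight p ess₂
  weight-++ p []          ess₂ = sym (+-identityˡ _)
  weight-++ p (es ∷ ess₁) ess₂ = trans (cong (_ +_) (weight-++ p ess₁ ess₂)) (sym (+-assoc _ _ _))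

  weight-cong : ∀ {p q} ess → (∀ es → p es ≡ q es) → weight p ess ≡ weight q ess
  weight-cong []          p≡q = refl
  weight-cong (es ∷ ess) p≡q rewrite p≡q es = cong (_ +_) (weight-cong ess p≡q)

  weight-filter : ∀ p q ess → weight q (filterᵇ p ess) ≡ weight (λ es → p es ∧ q es) ess
  weight-filter p q []          = refl
  weight-filter p q (es ∷ ess) with p es
  ... | true  = cong (_ +_) (weight-filter p q ess)
  ... | false = trans (weight-filter p q ess) (sym (+-identityˡ _))

  matchingIn : (Edge → Bool) → List Edge → Bool
  matchingIn P es = pairwiseDisjoint es ∧ allᵇ P es

  allᵇ-∧ : ∀ (P Q : Edge → Bool) es → allᵇ (λ f → P f ∧ Q f) es ≡ allᵇ P es ∧ allᵇ Q es
  allᵇ-∧ P Q []       = refl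
  allᵇ-∧ P Q (f ∷ es) rewrite allᵇ-∧ P Q es = shuffle (P f) (Q f) (allᵇ P es) (allᵇ Q es)
    where
      shuffle : ∀ a b c d → (a ∧ b) ∧ (c ∧ d) ≡ (a ∧ c) ∧ (b ∧ d)
      shuffle true  true  c d = refl
      shuffle true  false c d = sym (∧-zeroʳ c)
      shuffle false b     c d = refl

  matchingIn-cons : ∀ P e es → P e ≡ true →
    matchingIn P (e ∷ es) ≡ matchingIn (λ f → P f ∧ disjointE e f) es
  matchingIn-cons P e es Pe≡true rewrite Pe≡true | allᵇ-∧ P (disjointE e) es =
    shuffle (allᵇ (disjointE e) es) (pairwiseDisjoint es) (allᵇ P es)
    where
      shuffle : ∀ a b c → (a ∧ b) ∧ c ≡ b ∧ (c ∧ a)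
      shuffle true  true  c = sym (∧-identityʳ c)
      shuffle true  false c = refl
      shuffle false true  c = sym (∧-zeroʳ c)
      shuffle false false c = refl

  weight-prepend-allowed : ∀ P e ess → P e ≡ true →
    weight (matchingIn P) (map (e ∷_) ess) ≡ x * weight (matchingIn (λ f → P f ∧ disjointE e f)) ess
  weight-prepend-allowed P e []          Pe≡true = sym (zeroʳ x)
  weight-prepend-allowed P e (es ∷ ess) Pe≡true rewrite matchingIn-cons P e es Pe≡true =
    trans (cong₂ _+_ (pull-x (matchingIn (λ f → P f ∧ disjointE e f) es)) (weight-prepend-allowed P e ess Pe≡true))
          (sym (distribˡ x _ _))
    where
      pull-x : ∀ b → (if b then x * x ^ length es else 0#) ≡ x * (if b then x ^ length es else 0#)
      pull-x true  = refl
      pull-x false = sym (zeroʳ x)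

  weight-prepend-forbidden : ∀ P e ess → P e ≡ false → weight (matchingIn P) (map (e ∷_) ess) ≡ 0#
  weight-prepend-forbidden P e []          Pe≡false = refl
  weight-prepend-forbidden P e (es ∷ ess) Pe≡false rewrite Pe≡false | ∧-zeroʳ (pairwiseDisjoint (e ∷ es)) =
    trans (+-identityˡ _) (weight-prepend-forbidden P e ess Pe≡false)

  subsets-weight : ∀ P L → weight (matchingIn P) (subsets L) ≡ G P L
  subsets-weight P []      = +-identityʳ _
  subsets-weight P (e ∷ L) =
    trans (weight-++ (matchingIn P) (subsets L) (map (e ∷_) (subsets L)))
          (cong₂ _+_ (subsets-weight P L) (prepend (P e) refl))
    where
      prepend : ∀ b → P e ≡ b →
        weight (matchingIn P) (map (e ∷_) (subsets L)) ≡ (if b then x * G (λ f → P f ∧ disjointE e f) L else 0#)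
      prepend true  Pe≡true  = trans (weight-prepend-allowed P e (subsets L) Pe≡true)
                                     (cong (x *_) (subsets-weight (λ f → P f ∧ disjointE e f) L))
      prepend false Pe≡false = weight-prepend-forbidden P e (subsets L) Pe≡false

  sumTo-cong : ∀ n {f g : ℕ → Carrier} → (∀ k → f k ≡ g k) → sumTo n f ≡ sumTo n g
  sumTo-cong zero    f≡g = f≡g 0
  sumTo-cong (suc n) f≡g = cong₂ _+_ (sumTo-cong n f≡g) (f≡g (suc n))

  sumTo-+ : ∀ n (f g : ℕ → Carrier) → sumTo n (λ k → f k + g k) ≡ sumTo n f + sumTo n g
  sumTo-+ zero    f g = refl
  sumTo-+ (suc n) f g =
    trans (cong (_+ (f (suc n) + g (suc n))) (sumTo-+ n f g))
          (solve 4 (λ a b c d → (a :+ b) :+ (c :+ d) := (a :+ c) :+ (b :+ d)) refl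
                 (sumTo n f) (sumTo n g) (f (suc n)) (g (suc n)))

  sumTo-zero : ∀ n (f : ℕ → Carrier) → (∀ k → k ℕ.≤ n → f k ≡ 0#) → sumTo n f ≡ 0#
  sumTo-zero zero    f f≡0 = f≡0 0 z≤n
  sumTo-zero (suc n) f f≡0 =
    trans (cong₂ _+_ (sumTo-zero n f (λ k k≤n → f≡0 k (≤-trans k≤n (n≤1+n n)))) (f≡0 (suc n) ≤-refl))
          (+-identityʳ 0#)

  δ : ℕ → ℕ → Carrier
  δ l k = if l ℕ.≡ᵇ k then x ^ k else 0#

  δ-off : ∀ {l k} → l ≢ k → δ l k ≡ 0#
  δ-off {l} {k} l≢k rewrite dec-false (l ℕ.≟ k) l≢k = refl

  sumTo-δ : ∀ l n → l ℕ.≤ n → sumTo n (δ l) ≡ x ^ l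
  sumTo-δ zero zero z≤n = refl
  sumTo-δ l (suc n) l≤1+n with ℕP.m≤n⇒m<n∨m≡n l≤1+n
  ... | inj₁ (s≤s l≤n) =
    trans (cong₂ _+_ (sumTo-δ l n l≤n) (δ-off (ℕP.<⇒≢ (s≤s l≤n)))) (+-identityʳ _)
  ... | inj₂ refl =
    trans (cong₂ _+_ (sumTo-zero n (δ (suc n)) (λ k k≤n → δ-off (ℕP.>⇒≢ (s≤s k≤n))))
                     (cong (λ b → if b then x ^ suc n else 0#) (dec-true (suc n ℕ.≟ suc n) refl)))
          (+-identityˡ _)

  sizeTerm : List (List Edge) → ℕ → Carrier
  sizeTerm ess k = fromℕ (length (filterᵇ (λ es → length es ℕ.≡ᵇ k) ess)) * x ^ k

  sizeTerm-cons : ∀ es ess k → sizeTerm (es ∷ ess) k ≡ δ (length es) k + sizeTerm ess k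
  sizeTerm-cons es ess k with length es ℕ.≡ᵇ k
  ... | true  = trans (distribʳ (x ^ k) 1# _) (cong (_+ sizeTerm ess k) (*-identityˡ _))
  ... | false = sym (+-identityˡ _)

  sumTo-sizeTerm : ∀ ess n → All (λ es → length es ℕ.≤ n) ess →
                   sumTo n (sizeTerm ess) ≡ weight (λ _ → true) ess
  sumTo-sizeTerm []          n _          = sumTo-zero n (sizeTerm []) (λ k _ → zeroˡ _)
  sumTo-sizeTerm (es ∷ ess) n (es≤n ∷ ess≤n) =
    trans (sumTo-cong n (sizeTerm-cons es ess))
          (trans (sumTo-+ n (δ (length es)) (sizeTerm ess))
                 (cong₂ _+_ (sumTo-δ (length es) n es≤n) (sumTo-sizeTerm ess n ess≤n)))

  All-filterᵇ : ∀ {Q : List Edge → Set} p ess → All Q ess → All Q (filterᵇ p ess)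
  All-filterᵇ p []          []           = []
  All-filterᵇ p (es ∷ ess) (Qes ∷ Qess) with p es
  ... | true  = Qes ∷ All-filterᵇ p ess Qess
  ... | false = All-filterᵇ p ess Qess

  subsets-length : ∀ (L : List Edge) → All (λ es → length es ℕ.≤ length L) (subsets L)
  subsets-length []      = z≤n ∷ []
  subsets-length (e ∷ L) = ++⁺ (All.map (λ es≤L → ≤-trans es≤L (n≤1+n _)) (subsets-length L))
                               (map⁺ (All.map s≤s (subsets-length L)))

  allᵇ-keepAll : ∀ es → allᵇ keepAll es ≡ true
  allᵇ-keepAll []       = refl
  allᵇ-keepAll (e ∷ es) = allᵇ-keepAll es

  M-value : ∀ u → M u x ≡ matchPoly u
  M-value u = begin
    sumTo (length E) (sizeTerm (matchings u))
      ≡⟨ sumTo-sizeTerm (matchings u) (length E) (All-filterᵇ isMatching (subsets E) (subsets-length E)) ⟩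
    weight (λ _ → true) (filterᵇ isMatching (subsets E))
      ≡⟨ weight-filter isMatching (λ _ → true) (subsets E) ⟩
    weight (λ es → isMatching es ∧ true) (subsets E)
      ≡⟨ weight-cong (subsets E) (λ es → cong (pairwiseDisjoint es ∧_) (sym (allᵇ-keepAll es))) ⟩
    weight (matchingIn keepAll) (subsets E)
      ≡⟨ subsets-weight keepAll E ⟩
    G keepAll E
      ≡⟨ proj₁ (edgesAt-G root u) ⟩
    matchPoly u
      ∎
    where
      E : List Edge
      E = edges u

  M₀-value : ∀ u → M₀ u x ≡ matchPoly₀ u
  M₀-value u = begin
    sumTo (length E) (sizeTerm (matchings₀ u))
      ≡⟨ sumTo-sizeTerm (matchings₀ u) (length E)
           (All-filterᵇ rootFree (matchings u) (All-filterᵇ isMatching (subsets E) (subsets-length E))) ⟩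
    weight (λ _ → true) (filterᵇ rootFree (matchings u))
      ≡⟨ weight-filter rootFree (λ _ → true) (matchings u) ⟩
    weight (λ es → rootFree es ∧ true) (filterᵇ isMatching (subsets E))
      ≡⟨ weight-filter isMatching (λ es → rootFree es ∧ true) (subsets E) ⟩
    weight (λ es → isMatching es ∧ (rootFree es ∧ true)) (subsets E)
      ≡⟨ weight-cong (subsets E) (λ es → cong (pairwiseDisjoint es ∧_) (∧-identityʳ (rootFree es))) ⟩
    weight (matchingIn (avoids root)) (subsets E)
      ≡⟨ subsets-weight (avoids root) E ⟩
    G (avoids root) E
      ≡⟨ proj₂ (edgesAt-G root u) ⟩
    matchPoly₀ u
      ∎
    where
      E : List Edge
      E = edges u
      rootFree : List Edge → Bool
      rootFree = allᵇ (avoids root)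

  τ-value : ∀ u → τ u x ≡ matchPoly₀ u * matchPoly u ⁻¹
  τ-value u = cong₂ (λ p q → p * q ⁻¹) (M₀-value u) (M-value u)

-- Part 2: subdivided trees.

module Subdivision (F : OrderedField) (x : OrderedField.Carrier F)
                   (x>0 : OrderedField._<_ F (OrderedField.0# F) x) where
  open OrderedField F using (Carrier; _+_; _*_; 0#; _<_; +-mono-<; *-pos)
  open IsCommutativeRing (OrderedField.isCommutativeRing F) using (*-identityʳ)
  open OrderedFieldFacts F using (_≤_; 0<1; pos-+; <-+-pos; ≤-<-trans; *-monoˡ-≤; weighted-<)
  open MatchingRecurrence F x using (matchPoly; matchPoly₀; forestPoly; forestPoly₀)
  open import Algebra.Solver.Ring.NaturalCoefficients.Default
    (CommutativeRing.commutativeSemiring (commutativeRing F))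
  open ≡-Reasoning

  α β : Tree → Carrier
  α t = matchPoly (S t)
  β t = matchPoly₀ (S t)

  ρ ρ₀ : List Tree → Carrier
  ρ ts  = forestPoly (Ss ts)
  ρ₀ ts = forestPoly₀ (Ss ts)

  -- the weight of the pendant path root–mid–t when the root is left unmatched
  γ : Tree → Carrier
  γ t = α t + x * β t

  ρ-cons : ∀ t ts → ρ (t ∷ ts) ≡ γ t * ρ ts + x * (α t * ρ₀ ts)
  ρ-cons t ts rewrite *-identityʳ (α t) | *-identityʳ (β t) = refl

  ρ₀-cons : ∀ t ts → ρ₀ (t ∷ ts) ≡ γ t * ρ₀ ts
  ρ₀-cons t ts rewrite *-identityʳ (α t) | *-identityʳ (β t) = refl

  mutual
    positive : ∀ t → 0# < α t × 0# < β t
    positive (node ts) = forest-positive ts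

    forest-positive : ∀ ts → 0# < ρ ts × 0# < ρ₀ ts
    forest-positive []       = 0<1 , 0<1
    forest-positive (t ∷ ts) =
        subst (0# <_) (sym (ρ-cons t ts)) (pos-+ (*-pos (γ-pos t) ρ>0) (*-pos x>0 (*-pos (proj₁ (positive t)) ρ₀>0)))
      , subst (0# <_) (sym (ρ₀-cons t ts)) (*-pos (γ-pos t) ρ₀>0)
      where
        ρ>0 : 0# < ρ ts
        ρ>0 = proj₁ (forest-positive ts)
        ρ₀>0 : 0# < ρ₀ ts
        ρ₀>0 = proj₂ (forest-positive ts)

    γ-pos : ∀ t → 0# < γ t
    γ-pos t = pos-+ (proj₁ (positive t)) (*-pos x>0 (proj₂ (positive t)))

  weaken : ∀ {A : Set} {a' a : A} (f g : A → Carrier) →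
           a' ≡ a ⊎ f a * g a' < f a' * g a → f a * g a' ≤ f a' * g a
  weaken f g (inj₁ refl) = inj₁ refl
  weaken f g (inj₂ lt)   = inj₂ lt

  deleted-child : ∀ t {ts' ts} → ts' ≡ ts ⊎ ρ₀ ts * ρ ts' < ρ₀ ts' * ρ ts →
                  ρ₀ (t ∷ ts) * ρ ts' < ρ₀ ts' * ρ (t ∷ ts)
  deleted-child t {ts'} {ts} ih =
    subst₂ _<_ lhs rhs (≤-<-trans (*-monoˡ-≤ (γ-pos t) (weaken ρ₀ ρ ih)) (<-+-pos _ matched>0))
    where
      matched>0 : 0# < x * (α t * ρ₀ ts) * ρ₀ ts'
      matched>0 = *-pos (*-pos x>0 (*-pos (proj₁ (positive t)) (proj₂ (forest-positive ts))))
                        (proj₂ (forest-positive ts'))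
      lhs : γ t * (ρ₀ ts * ρ ts') ≡ ρ₀ (t ∷ ts) * ρ ts'
      lhs = begin
        γ t * (ρ₀ ts * ρ ts')
          ≡⟨ solve 3 (λ c r₀ r' → c :* (r₀ :* r') := (c :* r₀) :* r') refl (γ t) (ρ₀ ts) (ρ ts') ⟩
        (γ t * ρ₀ ts) * ρ ts'  ≡⟨ cong (_* ρ ts') (ρ₀-cons t ts) ⟨
        ρ₀ (t ∷ ts) * ρ ts'    ∎
      rhs : x * (α t * ρ₀ ts) * ρ₀ ts' + γ t * (ρ₀ ts' * ρ ts) ≡ ρ₀ ts' * ρ (t ∷ ts)
      rhs = begin
        x * (α t * ρ₀ ts) * ρ₀ ts' + γ t * (ρ₀ ts' * ρ ts)
          ≡⟨ solve 6 (λ x a c r₀ r₀' r →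
                        x :* (a :* r₀) :* r₀' :+ c :* (r₀' :* r) := r₀' :* (c :* r :+ x :* (a :* r₀)))
                   refl x (α t) (γ t) (ρ₀ ts) (ρ₀ ts') (ρ ts) ⟩
        ρ₀ ts' * (γ t * ρ ts + x * (α t * ρ₀ ts))
          ≡⟨ cong (ρ₀ ts' *_) (ρ-cons t ts) ⟨
        ρ₀ ts' * ρ (t ∷ ts)
          ∎

  -- For t ∷ ts and t' ∷ ts' both cross products expand with the same positive
  -- coefficients K₁, K₂ and the same remainder R, so a comparison of the forests
  -- and of the first children, at least one strict, is inherited.
  cons-cross-< : ∀ t t' ts ts' →
    (ρ₀ ts * ρ ts' < ρ₀ ts' * ρ ts × β t * α t' ≤ β t' * α t) ⊎
    (ρ₀ ts * ρ ts' ≤ ρ₀ ts' * ρ ts × β t * α t' < β t' * α t) →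
    ρ₀ (t ∷ ts) * ρ (t' ∷ ts') < ρ₀ (t' ∷ ts') * ρ (t ∷ ts)
  cons-cross-< t t' ts ts' cmp = subst₂ _<_ (sym left) (sym right) (+-mono-< R (weighted-< K₁>0 K₂>0 cmp))
    where
      K₁ K₂ R : Carrier
      K₁ = γ t * γ t'
      K₂ = x * x * (ρ₀ ts * ρ₀ ts')
      R  = x * (ρ₀ ts * ρ₀ ts') * (α t * α t')
      K₁>0 : 0# < K₁
      K₁>0 = *-pos (γ-pos t) (γ-pos t')
      K₂>0 : 0# < K₂
      K₂>0 = *-pos (*-pos x>0 x>0) (*-pos (proj₂ (forest-positive ts)) (proj₂ (forest-positive ts')))
      left : ρ₀ (t ∷ ts) * ρ (t' ∷ ts') ≡ K₁ * (ρ₀ ts * ρ ts') + K₂ * (β t * α t') + R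
      left = trans (cong₂ _*_ (ρ₀-cons t ts) (ρ-cons t' ts'))
        (solve 8 (λ x a b a' b' r₀ r₀' r' →
            ((a :+ x :* b) :* r₀) :* ((a' :+ x :* b') :* r' :+ x :* (a' :* r₀'))
              := ((a :+ x :* b) :* (a' :+ x :* b')) :* (r₀ :* r') :+ (x :* x :* (r₀ :* r₀')) :* (b :* a')
                 :+ x :* (r₀ :* r₀') :* (a :* a'))
          refl x (α t) (β t) (α t') (β t') (ρ₀ ts) (ρ₀ ts') (ρ ts'))
      right : ρ₀ (t' ∷ ts') * ρ (t ∷ ts) ≡ K₁ * (ρ₀ ts' * ρ ts) + K₂ * (β t' * α t) + R
      right = trans (cong₂ _*_ (ρ₀-cons t' ts') (ρ-cons t ts))
        (solve 8 (λ x a b a' b' r₀ r₀' r →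
            ((a' :+ x :* b') :* r₀') :* ((a :+ x :* b) :* r :+ x :* (a :* r₀))
              := ((a :+ x :* b) :* (a' :+ x :* b')) :* (r₀' :* r) :+ (x :* x :* (r₀ :* r₀')) :* (b' :* a)
                 :+ x :* (r₀ :* r₀') :* (a :* a'))
          refl x (α t) (β t) (α t') (β t') (ρ₀ ts) (ρ₀ ts') (ρ ts))

  kept-child : ∀ {t' t ts' ts} →
               t' ≡ t ⊎ β t * α t' < β t' * α t → ts' ≡ ts ⊎ ρ₀ ts * ρ ts' < ρ₀ ts' * ρ ts →
               t' ∷ ts' ≡ t ∷ ts ⊎ ρ₀ (t ∷ ts) * ρ (t' ∷ ts') < ρ₀ (t' ∷ ts') * ρ (t ∷ ts)
  kept-child (inj₁ refl) (inj₁ refl) = inj₁ refl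
  kept-child {t'} {t} {ts'} {ts} children (inj₂ forests) =
    inj₂ (cons-cross-< t t' ts ts' (inj₁ (forests , weaken β α children)))
  kept-child {t'} {t} {ts'} {ts} (inj₂ children) (inj₁ refl) =
    inj₂ (cons-cross-< t t' ts ts (inj₂ (inj₁ refl , children)))

  mutual
    cross-< : ∀ {t' t} → t' ⊑ t → t' ≡ t ⊎ β t * α t' < β t' * α t
    cross-< (node⊑ s) = Sum.map (cong node) (λ lt → lt) (forest-cross-< s)

    forest-cross-< : ∀ {ts' ts} → Sublist _⊑_ ts' ts → ts' ≡ ts ⊎ ρ₀ ts * ρ ts' < ρ₀ ts' * ρ ts
    forest-cross-< []          = inj₁ refl
    forest-cross-< (t ∷ʳ s)    = inj₂ (deleted-child t (forest-cross-< s))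
    forest-cross-< (t'⊑t ∷ s) = kept-child (cross-< t'⊑t) (forest-cross-< s)

lemma2p4 : (F : OrderedField) → (T T' : Tree) → T' ⊑ T → T' ≢ T →
    (x : OrderedField.Carrier F) → OrderedField._<_ F (OrderedField.0# F) x →
    OrderedField._<_ F (Poly.τ F (S T) x) (Poly.τ F (S T') x)
lemma2p4 F T T' T'⊑T T'≢T x x>0 = [ (λ T'≡T → ⊥-elim (T'≢T T'≡T)) , ratios ] (cross-< T'⊑T)
  where
    open OrderedField F using (_*_; _<_)
    open OrderedFieldFacts F using (quotient-<)
    open MatchingRecurrence F x using (τ-value)
    open Subdivision F x x>0 using (α; β; positive; cross-<)
    ratios : β T * α T' < β T' * α T → Poly.τ F (S T) x < Poly.τ F (S T') x
    ratios cross = subst₂ _<_ (sym (τ-value (S T))) (sym (τ-value (S T')))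
                          (quotient-< (proj₁ (positive T)) (proj₁ (positive T')) cross)
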